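{- Let $3\le p<q$ be relatively prime integers, let $s\ge 1$ be an integer with $\gcd(s,pq)=1$, and put $r=pq+s$. Let $a_m$ denote the coefficient of $z^m$ in $Q_{\{p,q,r\}}(z)$, let $m<pqr$ be an integer, and set \[ I'_1=(m-s-q-p,\,m-s-q]\cap\mathbb Z,\qquad I'_2=(m-s-p,\,m-s]\cap\mathbb Z . \] The set $I'_1\cup I'_2$ contains at most one multiple of $r$. If it contains no multiple of $r$, then $a_m=\Sigma_1$; if it contains a multiple $\alpha r$ of $r$ and $\alpha r\in I'_j$ ($j\in\{1,2\}$), then \[ a_m=\Sigma_1+(-\chi(\alpha r))^j, \] where $\Sigma_1=\sigma_s(m)-\sigma_s(m-p)-\sigma_s(m-q)+\sigma_s(m-q-p)$.
   Context: For pairwise relatively prime integers $p,q,r\ge 3$, $Q_{\{p,q,r\}}(z)=\frac{(z^{pqr}-1)(z^p-1)(z^q-1)(z^r-1)}{(z^{pq}-1)(z^{qr}-1)(z^{rp}-1)(z-1)}$, a polynomial of degree $(p-1)(q-1)(r-1)$; its coefficient $a_m$ is interpreted as $0$ for $m<0$ and for $m>(p-1)(q-1)(r-1)$. Every integer $n$ has a unique representation $n=x_nqr+y_nrp+z_npq+\delta_npqr$ with $0\le x_n<p$, $0\le y_n<q$, $0\le z_n<r$, $\delta_n\in\mathbb Z$; $n$ is called representable if $\delta_n\ge 0$, and $\chi(n)$ is $1$ if $n$ is representable and $0$ otherwise. For a positive integer $k$, $\sigma_k(m)=\sum_{m-k<n\le m}\chi(n)$. -}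

module Defs where

open import Data.Nat as ℕ using (ℕ; zero; suc; _∸_; _≡ᵇ_)
open import Data.Nat.Divisibility using (_∣?_)
open import Data.Integer as ℤ using (ℤ; +_; -[1+_]; _+_; _-_; _*_; -_)
open import Data.Bool using (Bool; true; false; if_then_else_)
open import Data.List using (List; upTo)
open import Data.Bool.ListAction using (any)
open import Relation.Nullary.Decidable using (does)
open import Data.Product using (_×_)

sumBelow : ℕ → (ℕ → ℤ) → ℤ
sumBelow zero    f = + 0
sumBelow (suc n) f = sumBelow n f + f n

Series : Set
Series = ℕ → ℤ

conv : Series → Series → Series
conv f g n = sumBelow (suc n) (λ i → f i * g (n ∸ i))

zpow-1 : ℕ → Series
zpow-1 k n = (if n ≡ᵇ k then + 1 else + 0) - (if n ≡ᵇ 0 then + 1 else + 0)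

-- the power series of 1/(z^k - 1) = - Σ_j z^{jk}   (k ≥ 1)
inv-zpow-1 : ℕ → Series
inv-zpow-1 k n = if does (k ∣? n) then - (+ 1) else + 0

-- Q_{p,q,r}(z) = (z^{pqr}-1)(z^p-1)(z^q-1)(z^r-1) / ((z^{pq}-1)(z^{qr}-1)(z^{rp}-1)(z-1)),
-- expanded as a power series (it is a polynomial under the standing hypotheses).
Qseries : ℕ → ℕ → ℕ → Series
Qseries p q r =
  conv (conv (zpow-1 (p ℕ.* q ℕ.* r)) (conv (zpow-1 p) (conv (zpow-1 q) (zpow-1 r))))
       (conv (inv-zpow-1 (p ℕ.* q)) (conv (inv-zpow-1 (q ℕ.* r))
             (conv (inv-zpow-1 (r ℕ.* p)) (inv-zpow-1 1))))

coeffQ : ℕ → ℕ → ℕ → ℤ → ℤ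
coeffQ p q r (+ n)    = Qseries p q r n
coeffQ p q r -[1+ n ] = + 0

-- n representable: n = x qr + y rp + z pq + δ pqr with 0≤x<p, 0≤y<q, 0≤z<r, δ ≥ 0.
-- For n ≥ 0 such δ satisfies δ ≤ n, so the search below is exhaustive.
representableᵇ : ℕ → ℕ → ℕ → ℤ → Bool
representableᵇ p q r (+ n) =
  any (λ x → any (λ y → any (λ z → any (λ d →
      (x ℕ.* q ℕ.* r ℕ.+ y ℕ.* r ℕ.* p ℕ.+ z ℕ.* p ℕ.* q ℕ.+ d ℕ.* p ℕ.* q ℕ.* r) ≡ᵇ n)
      (upTo (suc n))) (upTo r)) (upTo q)) (upTo p)
representableᵇ p q r -[1+ n ] = false

χ : ℕ → ℕ → ℕ → ℤ → ℤ
χ p q r n = if representableᵇ p q r n then + 1 else + 0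

-- σ_k(m) = Σ_{m-k < n ≤ m} χ(n) = Σ_{i<k} χ(m - i)
σ : ℕ → ℕ → ℕ → ℕ → ℤ → ℤ
σ p q r k m = sumBelow k (λ i → χ p q r (m - + i))

_∈⟨_,_] : ℤ → ℤ → ℤ → Set
x ∈⟨ a , b ] = (a ℤ.< x) × (x ℤ.≤ b)

module Submission where

-- Everything is phrased for functions ℤ → ℤ and the difference Δ k F x = F (x - k) - F x.
--  1. Power series: multiplying by z^k - 1 is a difference and dividing by it is undone by one,
--     so the coefficients a of Q satisfy Δ*[1,rp,qr,pq] a = -Δ*[p,q,r] δ below pqr (δ = [x = 0]).
--  2. A function vanishing on the negatives is determined below N by an iterated difference.
--  3. Representability is a threefold one-digit extension n = s + z·g (z < b); the indicator of
--     such a set is g-periodic off the multiples of b.  Applied at both levels this gives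
--     Δ*[rp,qr,pq] χ = -δ below pqr.  As Δ_1 σ_r = Δ_r χ, steps 1-3 yield the coefficient
--     formula a_m = σ_r(m) - σ_r(m-p) - σ_r(m-q) + σ_r(m-q-p).
--  4. A window of length ≤ r contains at most one multiple of r, and summing a function
--     supported on the multiples of r over it picks out the value there.
--  5. Splitting σ_r into σ_s and a window of length pq turns the coefficient formula into
--     a_m = Σ₁ + W(m-s) - W(m-s-q) for windows W of length p over I'₂ and I'₁; step 4 finishes.

open import Defs
open import Data.Nat as ℕ using (ℕ; zero; suc; _∸_; _≡ᵇ_; z≤n; s≤s)
import Data.Nat.Properties as ℕP
open import Data.Nat.Divisibility as ℕD using (_∣_; divides; _∣?_)
open import Data.Nat.Coprimality using (Coprime; coprime-divisor; coprime-+)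
import Data.Nat.Coprimality as Coprimality
open import Data.Integer as ℤ using (ℤ; +_; -[1+_]; _+_; _-_; _*_; -_; _^_; +<+; -<+)
import Data.Integer.Properties as ℤP
open import Data.Integer.Tactic.RingSolver using (solve-∀)
import Data.Nat.Tactic.RingSolver as ℕSolver
open import Data.Bool using (Bool; true; false; if_then_else_; T)
open import Data.Unit using (tt)
open import Data.List using (List; []; _∷_; _++_; upTo)
open import Data.Bool.ListAction using (any)
open import Data.List.Relation.Unary.Any.Properties using (any⁺; any⁻)
open import Data.List.Membership.Propositional using (find; lose)
open import Data.List.Membership.Propositional.Properties using (∈-upTo⁺; ∈-upTo⁻)
open import Data.List.Relation.Unary.All using (All; []; _∷_)
open import Data.Nat.Induction using (<-rec)
open import Data.List.Relation.Binary.Permutation.Propositional using (_↭_; prep; swap)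
import Data.List.Relation.Binary.Permutation.Propositional as Perm
open import Data.List.Relation.Binary.Permutation.Propositional.Properties using (shifts)
open import Data.Product using (Σ; _×_; _,_; proj₁; proj₂)
open import Data.Sum using (_⊎_; inj₁; inj₂)
open import Data.Empty using (⊥; ⊥-elim)
open import Function using (_∘′_)
open import Relation.Nullary using (¬_; Dec; yes; no)
open import Relation.Nullary.Decidable using (dec-true; dec-false)
open import Relation.Binary.PropositionalEquality
open import Relation.Binary using (tri<; tri≈; tri>)
import Relation.Binary.Reasoning.Setoid as SetoidReasoning

sumBelow-cong : ∀ n {f g : ℕ → ℤ} → (∀ i → i ℕ.< n → f i ≡ g i) → sumBelow n f ≡ sumBelow n g
sumBelow-cong zero    _ = refl
sumBelow-cong (suc n) h = cong₂ _+_ (sumBelow-cong n (λ i i<n → h i (ℕP.m<n⇒m<1+n i<n))) (h n ℕP.≤-refl)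

sumBelow-zero : ∀ n {f : ℕ → ℤ} → (∀ i → i ℕ.< n → f i ≡ + 0) → sumBelow n f ≡ + 0
sumBelow-zero zero    _ = refl
sumBelow-zero (suc n) h = cong₂ _+_ (sumBelow-zero n (λ i i<n → h i (ℕP.m<n⇒m<1+n i<n))) (h n ℕP.≤-refl)

sumBelow-head : ∀ n (f : ℕ → ℤ) → sumBelow (suc n) f ≡ f 0 + sumBelow n (λ i → f (suc i))
sumBelow-head zero    f = trans (ℤP.+-identityˡ (f 0)) (sym (ℤP.+-identityʳ (f 0)))
sumBelow-head (suc n) f = trans (cong (_+ f (suc n)) (sumBelow-head n f)) (ℤP.+-assoc (f 0) _ _)

sumBelow-+ : ∀ a b (f : ℕ → ℤ) → sumBelow (a ℕ.+ b) f ≡ sumBelow a f + sumBelow b (λ i → f (a ℕ.+ i))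
sumBelow-+ a zero    f rewrite ℕP.+-identityʳ a = sym (ℤP.+-identityʳ _)
sumBelow-+ a (suc b) f rewrite ℕP.+-suc a b =
  trans (cong (_+ f (a ℕ.+ b)) (sumBelow-+ a b f)) (ℤP.+-assoc (sumBelow a f) _ _)

sumBelow-- : ∀ n (f g : ℕ → ℤ) → sumBelow n (λ i → f i - g i) ≡ sumBelow n f - sumBelow n g
sumBelow-- zero    f g = refl
sumBelow-- (suc n) f g rewrite sumBelow-- n f g = regroup (sumBelow n f) (sumBelow n g) (f n) (g n)
  where
  regroup : ∀ a b c d → a - b + (c - d) ≡ a + c - (b + d)
  regroup = solve-∀

sumBelow-single : ∀ n (f : ℕ → ℤ) i₀ → i₀ ℕ.< n → (∀ i → i ℕ.< n → i ≢ i₀ → f i ≡ + 0) →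
                  sumBelow n f ≡ f i₀
sumBelow-single (suc n) f i₀ i₀<1+n others with i₀ ℕ.≟ n
... | yes refl = trans (cong (_+ f i₀) (sumBelow-zero n (λ i i<n → others i (ℕP.m<n⇒m<1+n i<n) (ℕP.<⇒≢ i<n))))
                       (ℤP.+-identityˡ _)
... | no i₀≢n  = trans (cong₂ _+_ (sumBelow-single n f i₀ (ℕP.≤∧≢⇒< (ℕP.≤-pred i₀<1+n) i₀≢n)
                                                     (λ i i<n → others i (ℕP.m<n⇒m<1+n i<n)))
                                  (others n ℕP.≤-refl (≢-sym i₀≢n)))
                       (ℤP.+-identityʳ _)

-- Formal power series.  Multiplication by z^k is a shift, multiplication by z^k - 1 the
-- difference operator Δˢ k, and 1/(z^k - 1) is undone by Δˢ k.

module ≗-Reasoning = SetoidReasoning (ℕ →-setoid ℤ)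

shift : ℕ → Series → Series
shift zero    f n       = f n
shift (suc k) f zero    = + 0
shift (suc k) f (suc n) = shift k f n

shift-below : ∀ k (f : Series) n → n ℕ.< k → shift k f n ≡ + 0
shift-below (suc k) f zero    _         = refl
shift-below (suc k) f (suc n) (s≤s n<k) = shift-below k f n n<k

shift-above : ∀ k (f : Series) j → shift k f (k ℕ.+ j) ≡ f j
shift-above zero    f j = refl
shift-above (suc k) f j = shift-above k f j

shift-cong : ∀ k {f g : Series} → f ≗ g → shift k f ≗ shift k g
shift-cong zero    f≗g n       = f≗g n
shift-cong (suc k) f≗g zero    = refl
shift-cong (suc k) f≗g (suc n) = shift-cong k f≗g n

Δˢ : ℕ → Series → Series
Δˢ k f n = shift k f n - f n

Δˢ-cong : ∀ k {f g : Series} → f ≗ g → Δˢ k f ≗ Δˢ k g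
Δˢ-cong k f≗g n = cong₂ _-_ (shift-cong k f≗g n) (f≗g n)

Δˢ* : List ℕ → Series → Series
Δˢ* []       f = f
Δˢ* (k ∷ ks) f = Δˢ k (Δˢ* ks f)

Δˢ*-cong : ∀ ks {f g : Series} → f ≗ g → Δˢ* ks f ≗ Δˢ* ks g
Δˢ*-cong []       f≗g = f≗g
Δˢ*-cong (k ∷ ks) f≗g = Δˢ-cong k (Δˢ*-cong ks f≗g)

conv-cong : ∀ {f f' g g' : Series} → f ≗ f' → g ≗ g' → conv f g ≗ conv f' g'
conv-cong f≗f' g≗g' n = sumBelow-cong (suc n) (λ i _ → cong₂ _*_ (f≗f' i) (g≗g' (n ∸ i)))

conv-congʳ : ∀ (f : Series) {g g' : Series} → g ≗ g' → conv f g ≗ conv f g'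
conv-congʳ f = conv-cong {f = f} (λ _ → refl)

conv-shiftʳ : ∀ k (f g : Series) → conv f (shift k g) ≗ shift k (conv f g)
conv-shiftʳ zero    f g n       = refl
conv-shiftʳ (suc k) f g zero    = trans (ℤP.+-identityˡ _) (ℤP.*-zeroʳ (f 0))
conv-shiftʳ (suc k) f g (suc n) = begin
  sumBelow (suc n) (λ i → f i * shift (suc k) g (suc n ∸ i)) + f (suc n) * shift (suc k) g (suc n ∸ suc n)
    ≡⟨ cong₂ _+_ (sumBelow-cong (suc n) (λ i i<1+n →
                   cong (λ t → f i * shift (suc k) g t) (ℕP.+-∸-assoc 1 (ℕP.≤-pred i<1+n))))
                 (cong (λ t → f (suc n) * shift (suc k) g t) (ℕP.n∸n≡0 (suc n))) ⟩
  conv f (shift k g) n + f (suc n) * + 0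
    ≡⟨ cong₂ _+_ (conv-shiftʳ k f g n) (ℤP.*-zeroʳ (f (suc n))) ⟩
  shift k (conv f g) n + + 0
    ≡⟨ ℤP.+-identityʳ _ ⟩
  shift k (conv f g) n ∎
  where open ≡-Reasoning

conv-shiftˡ : ∀ k (f g : Series) → conv (shift k f) g ≗ shift k (conv f g)
conv-shiftˡ zero    f g n       = refl
conv-shiftˡ (suc k) f g zero    = refl
conv-shiftˡ (suc k) f g (suc n) =
  trans (sumBelow-head (suc n) (λ i → shift (suc k) f i * g (suc n ∸ i)))
        (trans (ℤP.+-identityˡ _) (conv-shiftˡ k f g n))

conv-Δˢʳ : ∀ k (f g : Series) → conv f (Δˢ k g) ≗ Δˢ k (conv f g)
conv-Δˢʳ k f g n =
  trans (sumBelow-cong (suc n) (λ i _ → distrib (f i) (shift k g (n ∸ i)) (g (n ∸ i))))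
  (trans (sumBelow-- (suc n) (λ i → f i * shift k g (n ∸ i)) (λ i → f i * g (n ∸ i)))
         (cong (_- conv f g n) (conv-shiftʳ k f g n)))
  where
  distrib : ∀ a b c → a * (b - c) ≡ a * b - a * c
  distrib = solve-∀

conv-Δˢˡ : ∀ k (f g : Series) → conv (Δˢ k f) g ≗ Δˢ k (conv f g)
conv-Δˢˡ k f g n =
  trans (sumBelow-cong (suc n) (λ i _ → distrib (shift k f i) (f i) (g (n ∸ i))))
  (trans (sumBelow-- (suc n) (λ i → shift k f i * g (n ∸ i)) (λ i → f i * g (n ∸ i)))
         (cong (_- conv f g n) (conv-shiftˡ k f g n)))
  where
  distrib : ∀ a b c → (a - b) * c ≡ a * c - b * c
  distrib = solve-∀

one : Series
one zero    = + 1
one (suc n) = + 0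

conv-oneˡ : ∀ (g : Series) → conv one g ≗ g
conv-oneˡ g n =
  trans (sumBelow-head n (λ i → one i * g (n ∸ i)))
        (trans (cong₂ _+_ (ℤP.*-identityˡ (g n)) (sumBelow-zero n (λ i _ → refl))) (ℤP.+-identityʳ (g n)))

conv-oneʳ : ∀ (f : Series) → conv f one ≗ f
conv-oneʳ f n =
  trans (cong₂ _+_ (sumBelow-zero n (λ i i<n → trans (cong (λ t → f i * one t) (∸-pos i<n)) (ℤP.*-zeroʳ (f i))))
                   (cong (λ t → f n * one t) (ℕP.n∸n≡0 n)))
        (trans (ℤP.+-identityˡ _) (ℤP.*-identityʳ (f n)))
  where
  ∸-pos : ∀ {i n} → i ℕ.< n → n ∸ i ≡ suc (n ∸ suc i)
  ∸-pos {i} (s≤s i≤n) = ℕP.+-∸-assoc 1 i≤n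

shift-one : ∀ k n → shift k one n ≡ (if n ≡ᵇ k then + 1 else + 0)
shift-one zero    zero    = refl
shift-one zero    (suc n) = refl
shift-one (suc k) zero    = refl
shift-one (suc k) (suc n) = shift-one k n

zpow-1≗Δˢ : ∀ k → zpow-1 k ≗ Δˢ k one
zpow-1≗Δˢ k zero    = cong (_- + 1) (sym (shift-one k zero))
zpow-1≗Δˢ k (suc n) = cong (_- + 0) (sym (shift-one k (suc n)))

conv-zpow-1 : ∀ k (g : Series) → conv (zpow-1 k) g ≗ Δˢ k g
conv-zpow-1 k g n =
  trans (conv-cong {g = g} (zpow-1≗Δˢ k) (λ _ → refl) n)
        (trans (conv-Δˢˡ k one g n) (Δˢ-cong k (conv-oneˡ g) n))

-- (z^k - 1) · 1/(z^k - 1) = 1: the coefficients of 1/(z^k - 1) are -1 at multiples of k and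
-- 0 elsewhere, so they are k-periodic and equal -1 at the start.
inv-zpow-1-multiple : ∀ k n → k ∣ n → inv-zpow-1 k n ≡ - (+ 1)
inv-zpow-1-multiple k n k∣n rewrite dec-true (k ∣? n) k∣n = refl

inv-zpow-1-nonmultiple : ∀ k n → ¬ k ∣ n → inv-zpow-1 k n ≡ + 0
inv-zpow-1-nonmultiple k n k∤n rewrite dec-false (k ∣? n) k∤n = refl

inv-zpow-1-periodic : ∀ k j → inv-zpow-1 k (k ℕ.+ j) ≡ inv-zpow-1 k j
inv-zpow-1-periodic k j = by-cases (k ∣? j)
  where
  by-cases : Dec (k ∣ j) → inv-zpow-1 k (k ℕ.+ j) ≡ inv-zpow-1 k j
  by-cases (yes k∣j) = trans (inv-zpow-1-multiple k _ (ℕD.∣m∣n⇒∣m+n ℕD.∣-refl k∣j))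
                             (sym (inv-zpow-1-multiple k j k∣j))
  by-cases (no k∤j)  = trans (inv-zpow-1-nonmultiple k _ (λ k∣ → k∤j (ℕD.∣m+n∣m⇒∣n k∣ ℕD.∣-refl)))
                             (sym (inv-zpow-1-nonmultiple k j k∤j))

Δˢ-inv-zpow-1 : ∀ k → 1 ℕ.≤ k → Δˢ k (inv-zpow-1 k) ≗ one
Δˢ-inv-zpow-1 k@(suc k') _ n with ℕP.<-≤-connex n k
... | inj₁ n<k rewrite shift-below k (inv-zpow-1 k) n n<k = below n n<k
  where
  below : ∀ n → n ℕ.< k → + 0 - inv-zpow-1 k n ≡ one n
  below zero    _   rewrite inv-zpow-1-multiple k 0 (k ℕD.∣0) = refl
  below (suc n) n<k rewrite inv-zpow-1-nonmultiple k (suc n) (λ k∣ → ℕP.<⇒≱ n<k (ℕD.∣⇒≤ k∣)) = refl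
... | inj₂ k≤n with n ∸ k | ℕP.m+[n∸m]≡n k≤n
...   | j | refl rewrite shift-above k (inv-zpow-1 k) j | inv-zpow-1-periodic k j = ℤP.+-inverseʳ (inv-zpow-1 k j)

cancel-inv-zpow-1 : ∀ k (A h : Series) → 1 ℕ.≤ k → Δˢ k (conv A (conv (inv-zpow-1 k) h)) ≗ conv A h
cancel-inv-zpow-1 k A h 1≤k = begin
  Δˢ k (conv A (conv (inv-zpow-1 k) h))  ≈⟨ (λ n → sym (conv-Δˢʳ k A (conv (inv-zpow-1 k) h) n)) ⟩
  conv A (Δˢ k (conv (inv-zpow-1 k) h))  ≈⟨ conv-congʳ A (λ n → sym (conv-Δˢˡ k (inv-zpow-1 k) h n)) ⟩
  conv A (conv (Δˢ k (inv-zpow-1 k)) h)  ≈⟨ conv-congʳ A (conv-cong {g = h} (Δˢ-inv-zpow-1 k 1≤k) (λ _ → refl)) ⟩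
  conv A (conv one h)                    ≈⟨ conv-congʳ A (conv-oneˡ h) ⟩
  conv A h                               ∎
  where open ≗-Reasoning

cancel-last-inv-zpow-1 : ∀ k (A : Series) → 1 ℕ.≤ k → Δˢ k (conv A (inv-zpow-1 k)) ≗ A
cancel-last-inv-zpow-1 k A 1≤k = begin
  Δˢ k (conv A (inv-zpow-1 k))  ≈⟨ (λ n → sym (conv-Δˢʳ k A (inv-zpow-1 k) n)) ⟩
  conv A (Δˢ k (inv-zpow-1 k))  ≈⟨ conv-congʳ A (Δˢ-inv-zpow-1 k 1≤k) ⟩
  conv A one                    ≈⟨ conv-oneʳ A ⟩
  A                             ∎
  where open ≗-Reasoning

numerator≗Δˢ* : ∀ a b c d →
  conv (zpow-1 a) (conv (zpow-1 b) (conv (zpow-1 c) (zpow-1 d))) ≗ Δˢ* (a ∷ b ∷ c ∷ d ∷ []) one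
numerator≗Δˢ* a b c d n =
  trans (conv-zpow-1 a _ n) (Δˢ-cong a (λ n' →
  trans (conv-zpow-1 b _ n') (Δˢ-cong b (λ n'' →
  trans (conv-zpow-1 c _ n'') (Δˢ-cong c (zpow-1≗Δˢ d) n'')) n')) n)

Qseries-difference : ∀ p q r → 1 ℕ.≤ p ℕ.* q → 1 ℕ.≤ q ℕ.* r → 1 ℕ.≤ r ℕ.* p →
  Δˢ* (1 ∷ r ℕ.* p ∷ q ℕ.* r ∷ p ℕ.* q ∷ []) (Qseries p q r) ≗ Δˢ* (p ℕ.* q ℕ.* r ∷ p ∷ q ∷ r ∷ []) one
Qseries-difference p q r 1≤pq 1≤qr 1≤rp = begin
  Δˢ 1 (Δˢ (r ℕ.* p) (Δˢ (q ℕ.* r) (Δˢ (p ℕ.* q) (conv N (conv (inv-zpow-1 (p ℕ.* q)) B₁)))))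
    ≈⟨ Δˢ*-cong (1 ∷ r ℕ.* p ∷ q ℕ.* r ∷ []) (cancel-inv-zpow-1 (p ℕ.* q) N B₁ 1≤pq) ⟩
  Δˢ 1 (Δˢ (r ℕ.* p) (Δˢ (q ℕ.* r) (conv N (conv (inv-zpow-1 (q ℕ.* r)) B₂))))
    ≈⟨ Δˢ*-cong (1 ∷ r ℕ.* p ∷ []) (cancel-inv-zpow-1 (q ℕ.* r) N B₂ 1≤qr) ⟩
  Δˢ 1 (Δˢ (r ℕ.* p) (conv N (conv (inv-zpow-1 (r ℕ.* p)) (inv-zpow-1 1))))
    ≈⟨ Δˢ-cong 1 (cancel-inv-zpow-1 (r ℕ.* p) N (inv-zpow-1 1) 1≤rp) ⟩
  Δˢ 1 (conv N (inv-zpow-1 1))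
    ≈⟨ cancel-last-inv-zpow-1 1 N ℕP.≤-refl ⟩
  N
    ≈⟨ numerator≗Δˢ* (p ℕ.* q ℕ.* r) p q r ⟩
  Δˢ* (p ℕ.* q ℕ.* r ∷ p ∷ q ∷ r ∷ []) one ∎
  where
  open ≗-Reasoning
  N B₁ B₂ : Series
  N  = conv (zpow-1 (p ℕ.* q ℕ.* r)) (conv (zpow-1 p) (conv (zpow-1 q) (zpow-1 r)))
  B₂ = conv (inv-zpow-1 (r ℕ.* p)) (inv-zpow-1 1)
  B₁ = conv (inv-zpow-1 (q ℕ.* r)) B₂

minus-≤ : ∀ x k → x - + k ℤ.≤ x
minus-≤ x k = ℤP.i-j≤i x (+ k)

minus-below : ∀ {x y} k → x ℤ.< y → x - + k ℤ.< y
minus-below {x} k x<y = ℤP.≤-<-trans (minus-≤ x k) x<y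

below-minus-neg : ∀ {x} k → x ℤ.< + k → x - + k ℤ.< + 0
below-minus-neg {x} k x<k = subst (x - + k ℤ.<_) (ℤP.+-inverseʳ (+ k)) (ℤP.+-monoˡ-< (- + k) x<k)

nat-minus-neg : ∀ n k → n ℕ.< k → + n - + k ℤ.< + 0
nat-minus-neg n (suc k) (s≤s n≤k)
  rewrite ℤP.m-n≡m⊖n n (suc k) | ℤP.⊖-< (s≤s n≤k) | ℕP.+-∸-assoc 1 n≤k = -<+

nat-minus-above : ∀ k j → + (k ℕ.+ j) - + k ≡ + j
nat-minus-above k j = cancel (+ k) (+ j)
  where
  cancel : ∀ a b → a + b - a ≡ b
  cancel = solve-∀

nat-minus : ∀ n k → (n ℕ.< k × + n - + k ℤ.< + 0) ⊎ Σ ℕ (λ j → k ℕ.+ j ≡ n × + n - + k ≡ + j)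
nat-minus n k with ℕP.<-≤-connex n k
... | inj₁ n<k = inj₁ (n<k , nat-minus-neg n k n<k)
... | inj₂ k≤n = inj₂ (n ∸ k , ℕP.m+[n∸m]≡n k≤n ,
                       trans (cong (λ t → + t - + k) (sym (ℕP.m+[n∸m]≡n k≤n))) (nat-minus-above k (n ∸ k)))

-- Functions on ℤ.  A series is extended by zero to the negative integers, and on functions
-- ℤ → ℤ multiplication by z^k - 1 becomes the difference operator Δ k F x = F (x - k) - F x.

ext : Series → ℤ → ℤ
ext f (+ n)    = f n
ext f -[1+ n ] = + 0

VanishesBelow : (ℤ → ℤ) → ℤ → Set
VanishesBelow F x₀ = ∀ y → y ℤ.< x₀ → F y ≡ + 0

ext-vanishes : ∀ f → VanishesBelow (ext f) (+ 0)
ext-vanishes f -[1+ n ] _        = refl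
ext-vanishes f (+ n)    (+<+ ())

ext-shift : ∀ f n k → ext f (+ n - + k) ≡ shift k f n
ext-shift f n k with ℕP.<-≤-connex n k
... | inj₁ n<k = trans (ext-vanishes f _ (nat-minus-neg n k n<k)) (sym (shift-below k f n n<k))
... | inj₂ k≤n with n ∸ k | ℕP.m+[n∸m]≡n k≤n
...   | j | refl = trans (cong (ext f) (nat-minus-above k j)) (sym (shift-above k f j))

Δ : ℕ → (ℤ → ℤ) → ℤ → ℤ
Δ k F x = F (x - + k) - F x

Δ* : List ℕ → (ℤ → ℤ) → ℤ → ℤ
Δ* []       F = F
Δ* (k ∷ ks) F = Δ k (Δ* ks F)

Δ-cong : ∀ k {F G : ℤ → ℤ} → F ≗ G → Δ k F ≗ Δ k G
Δ-cong k F≗G x = cong₂ _-_ (F≗G (x - + k)) (F≗G x)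

Δ*-cong : ∀ ks {F G : ℤ → ℤ} → F ≗ G → Δ* ks F ≗ Δ* ks G
Δ*-cong []       F≗G = F≗G
Δ*-cong (k ∷ ks) F≗G = Δ-cong k (Δ*-cong ks F≗G)

ext-Δˢ : ∀ k f → ext (Δˢ k f) ≗ Δ k (ext f)
ext-Δˢ k f (+ n)    = cong (_- f n) (sym (ext-shift f n k))
ext-Δˢ k f -[1+ n ] = sym (cong (_- + 0) (ext-vanishes f _ (minus-below k -<+)))

ext-Δˢ* : ∀ ks f → ext (Δˢ* ks f) ≗ Δ* ks (ext f)
ext-Δˢ* []       f x = refl
ext-Δˢ* (k ∷ ks) f x = trans (ext-Δˢ k (Δˢ* ks f) x) (Δ-cong k (ext-Δˢ* ks f) x)

Δ-comm : ∀ a b F → Δ a (Δ b F) ≗ Δ b (Δ a F)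
Δ-comm a b F x =
  trans (cong (λ t → F t - F (x - + a) - (F (x - + b) - F x)) (swap-steps x (+ a) (+ b)))
        (regroup (F (x - + b - + a)) (F (x - + a)) (F (x - + b)) (F x))
  where
  swap-steps : ∀ x a b → x - a - b ≡ x - b - a
  swap-steps = solve-∀
  regroup : ∀ u v w z → u - v - (w - z) ≡ u - w - (v - z)
  regroup = solve-∀

Δ*-perm : ∀ {ks ls} F → ks ↭ ls → Δ* ks F ≗ Δ* ls F
Δ*-perm F Perm.refl              = λ _ → refl
Δ*-perm F (prep k ks↭ls)         = Δ-cong k (Δ*-perm F ks↭ls)
Δ*-perm F (swap {xs = ks} k l ks↭ls) x =
  trans (Δ-comm k l (Δ* ks F) x) (Δ-cong l (Δ-cong k (Δ*-perm F ks↭ls)) x)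
Δ*-perm F (Perm.trans p₁ p₂) x   = trans (Δ*-perm F p₁ x) (Δ*-perm F p₂ x)

Δ*-neg : ∀ ks F → Δ* ks (λ x → - F x) ≗ (λ x → - Δ* ks F x)
Δ*-neg []       F x = refl
Δ*-neg (k ∷ ks) F x =
  trans (Δ-cong k (Δ*-neg ks F) x) (negate (Δ* ks F (x - + k)) (Δ* ks F x))
  where
  negate : ∀ a b → - a - - b ≡ - (a - b)
  negate = solve-∀

Δ*-sub : ∀ ks F G → Δ* ks (λ x → F x - G x) ≗ (λ x → Δ* ks F x - Δ* ks G x)
Δ*-sub []       F G x = refl
Δ*-sub (k ∷ ks) F G x =
  trans (Δ-cong k (Δ*-sub ks F G) x)
        (regroup (Δ* ks F (x - + k)) (Δ* ks G (x - + k)) (Δ* ks F x) (Δ* ks G x))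
  where
  regroup : ∀ a b c d → a - b - (c - d) ≡ a - c - (b - d)
  regroup = solve-∀

-- Δ* only looks backwards: functions agreeing below N have differences agreeing below N
Δ*-agree : ∀ ks {F G N} → (∀ y → y ℤ.< N → F y ≡ G y) → ∀ y → y ℤ.< N → Δ* ks F y ≡ Δ* ks G y
Δ*-agree []       F≡G = F≡G
Δ*-agree (k ∷ ks) F≡G y y<N =
  cong₂ _-_ (Δ*-agree ks F≡G _ (minus-below k y<N)) (Δ*-agree ks F≡G y y<N)

Δ*-vanishes : ∀ ks {F x₀} → VanishesBelow F x₀ → VanishesBelow (Δ* ks F) x₀
Δ*-vanishes []       F-van = F-van
Δ*-vanishes (k ∷ ks) F-van y y<x₀ =
  cong₂ _-_ (Δ*-vanishes ks F-van _ (minus-below k y<x₀)) (Δ*-vanishes ks F-van y y<x₀)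

Δ-from-zero : ∀ k {F : ℤ → ℤ} {x} → F (x - + k) ≡ + 0 → Δ k F x ≡ - F x
Δ-from-zero k {F} {x} F[x-k]≡0 = trans (cong (_- F x) F[x-k]≡0) (ℤP.+-identityˡ _)

-- A function vanishing on the negative integers whose k-th difference (k ≥ 1) vanishes below N
-- vanishes below N itself: by strong induction, E x = E (x - k) for 0 ≤ x < N.
Δ-vanishing : ∀ k N E → 1 ℕ.≤ k → VanishesBelow E (+ 0) → VanishesBelow (Δ k E) N → VanishesBelow E N
Δ-vanishing k N E 1≤k E-neg ΔE-van -[1+ n ] _ = E-neg _ -<+
Δ-vanishing k N E 1≤k E-neg ΔE-van (+ n)      = <-rec (λ n → + n ℤ.< N → E (+ n) ≡ + 0) step n
  where
  step : ∀ n → (∀ {m} → m ℕ.< n → + m ℤ.< N → E (+ m) ≡ + 0) → + n ℤ.< N → E (+ n) ≡ + 0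
  step n earlier n<N = trans (sym (ℤP.i-j≡0⇒i≡j _ _ (ΔE-van (+ n) n<N))) (back (nat-minus n k))
    where
    back : (n ℕ.< k × + n - + k ℤ.< + 0) ⊎ Σ ℕ (λ j → k ℕ.+ j ≡ n × + n - + k ≡ + j) →
           E (+ n - + k) ≡ + 0
    back (inj₁ (_ , neg))       = E-neg _ neg
    back (inj₂ (j , k+j≡n , e)) = trans (cong E e) (earlier j<n (ℤP.≤-<-trans (ℤ.+≤+ j≤n) n<N))
      where
      j<n : j ℕ.< n
      j<n = subst (j ℕ.<_) k+j≡n (ℕP.m<n+m j 1≤k)
      j≤n : j ℕ.≤ n
      j≤n = ℕP.<⇒≤ j<n

Δ*-vanishing : ∀ ks N E → All (1 ℕ.≤_) ks → VanishesBelow E (+ 0) → VanishesBelow (Δ* ks E) N →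
               VanishesBelow E N
Δ*-vanishing []       N E []           E-neg ΔE-van = ΔE-van
Δ*-vanishing (k ∷ ks) N E (1≤k ∷ 1≤ks) E-neg ΔE-van =
  Δ*-vanishing ks N E 1≤ks E-neg (Δ-vanishing k N (Δ* ks E) 1≤k (Δ*-vanishes ks E-neg) ΔE-van)

Δ*-uniqueness : ∀ ks N (F G : ℤ → ℤ) → All (1 ℕ.≤_) ks →
  (∀ y → y ℤ.< + 0 → F y ≡ G y) → (∀ y → y ℤ.< N → Δ* ks F y ≡ Δ* ks G y) →
  ∀ y → y ℤ.< N → F y ≡ G y
Δ*-uniqueness ks N F G 1≤ks F≡G-neg ΔF≡ΔG y y<N =
  ℤP.i-j≡0⇒i≡j _ _ (Δ*-vanishing ks N (λ x → F x - G x) 1≤ks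
                       (λ x x<0 → difference-zero (F≡G-neg x x<0))
                       (λ x x<N → trans (Δ*-sub ks F G x) (difference-zero (ΔF≡ΔG x x<N))) y y<N)
  where
  difference-zero : ∀ {a b} → a ≡ b → a - b ≡ + 0
  difference-zero {a} refl = ℤP.+-inverseʳ a

δ : ℤ → ℤ
δ = ext one

ext-cong : ∀ {f g : Series} → f ≗ g → ext f ≗ ext g
ext-cong f≗g (+ n)    = f≗g n
ext-cong f≗g -[1+ n ] = refl

coeffQ≗ext : ∀ p q r → coeffQ p q r ≗ ext (Qseries p q r)
coeffQ≗ext p q r (+ n)    = refl
coeffQ≗ext p q r -[1+ n ] = refl

coeffQ-difference : ∀ p q r → 1 ℕ.≤ p → 1 ℕ.≤ q → 1 ℕ.≤ r → ∀ x → x ℤ.< + (p ℕ.* q ℕ.* r) →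
  Δ* (1 ∷ r ℕ.* p ∷ q ℕ.* r ∷ p ℕ.* q ∷ []) (coeffQ p q r) x ≡ - Δ* (p ∷ q ∷ r ∷ []) δ x
coeffQ-difference p q r 1≤p 1≤q 1≤r x x<pqr = begin
  Δ* ks (coeffQ p q r) x                 ≡⟨ Δ*-cong ks (coeffQ≗ext p q r) x ⟩
  Δ* ks (ext (Qseries p q r)) x          ≡⟨ ext-Δˢ* ks (Qseries p q r) x ⟨
  ext (Δˢ* ks (Qseries p q r)) x         ≡⟨ ext-cong (Qseries-difference p q r 1≤pq 1≤qr 1≤rp) x ⟩
  ext (Δˢ* (pqr ∷ ls) one) x             ≡⟨ ext-Δˢ* (pqr ∷ ls) one x ⟩
  Δ pqr (Δ* ls δ) x                      ≡⟨ Δ-from-zero pqr {Δ* ls δ} {x} (Δ*-vanishes ls (ext-vanishes one) _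
                                                                       (below-minus-neg pqr x<pqr)) ⟩
  - Δ* ls δ x                            ∎
  where
  open ≡-Reasoning
  ks ls : List ℕ
  ks  = 1 ∷ r ℕ.* p ∷ q ℕ.* r ∷ p ℕ.* q ∷ []
  ls  = p ∷ q ∷ r ∷ []
  pqr : ℕ
  pqr = p ℕ.* q ℕ.* r
  1≤pq : 1 ℕ.≤ p ℕ.* q
  1≤pq = ℕP.*-mono-≤ 1≤p 1≤q
  1≤qr : 1 ℕ.≤ q ℕ.* r
  1≤qr = ℕP.*-mono-≤ 1≤q 1≤r
  1≤rp : 1 ℕ.≤ r ℕ.* p
  1≤rp = ℕP.*-mono-≤ 1≤r 1≤p

Multiple : ℕ → ℤ → Set
Multiple b w = Σ ℤ λ α → w ≡ α * + b

nat-multiple : ∀ {b n} → b ∣ n → Multiple b (+ n)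
nat-multiple {b} (divides c refl) = + c , ℤP.pos-* c b

negative-multiple : ∀ a b → 1 ℕ.≤ b → -[1+ a ] * + b ℤ.< + 0
negative-multiple a (suc b) _ = -<+

multiple? : ∀ b w → Multiple b w ⊎ ¬ Multiple b w
multiple? b (+ n) with b ∣? n
... | yes b∣n = inj₁ (nat-multiple b∣n)
... | no  b∤n = inj₂ (λ (α , e) → b∤n (divides ℤ.∣ α ∣ (trans (cong ℤ.∣_∣ e) (ℤP.abs-* α (+ b)))))
multiple? b -[1+ n ] with b ∣? suc n
... | yes (divides c 1+n≡cb) =
  inj₁ (- + c , trans (cong (λ t → - + t) 1+n≡cb)
                      (trans (cong -_ (ℤP.pos-* c b)) (ℤP.neg-distribˡ-* (+ c) (+ b))))
... | no  b∤n = inj₂ (λ (α , e) → b∤n (divides ℤ.∣ α ∣ (trans (cong ℤ.∣_∣ e) (ℤP.abs-* α (+ b)))))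

scale-< : ∀ {α} n b → 1 ℕ.≤ b → α ℤ.< + n → α * + b ℤ.< + (n ℕ.* b)
scale-< {α} n (suc b) _ α<n = subst (α * + suc b ℤ.<_) (sym (ℤP.pos-* n (suc b))) (ℤP.*-monoʳ-<-pos (+ suc b) α<n)

unscale-< : ∀ {α} n b → α * + b ℤ.< + (n ℕ.* b) → α ℤ.< + n
unscale-< {α} n b αb<nb = ℤP.*-cancelʳ-<-nonNeg (+ b) (subst (α * + b ℤ.<_) (ℤP.pos-* n b) αb<nb)

δ-nonzero : ∀ y → y ≢ + 0 → δ y ≡ + 0
δ-nonzero (+ zero)  y≢0 = ⊥-elim (y≢0 refl)
δ-nonzero (+ suc n) _   = refl
δ-nonzero -[1+ n ]  _   = refl

δ-multiple : ∀ α b → 1 ℕ.≤ b → δ (α * + b) ≡ δ α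
δ-multiple (+ zero)  b       _ = refl
δ-multiple (+ suc a) (suc b) _ = refl
δ-multiple -[1+ a ]  (suc b) _ = refl

Δ-on-multiples : ∀ k a b (F : ℤ → ℤ) → k ≡ a ℕ.* b → ∀ α → Δ k F (α * + b) ≡ Δ a (λ β → F (β * + b)) α
Δ-on-multiples _ a b F refl α =
  cong (λ t → F t - F (α * + b)) (trans (cong (λ t → α * + b - t) (ℤP.pos-* a b)) (factor α (+ a) (+ b)))
  where
  factor : ∀ α a b → α * b - a * b ≡ (α - a) * b
  factor = solve-∀

Δ-off-multiples : ∀ k a b (F : ℤ → ℤ) → k ≡ a ℕ.* b → (∀ w → ¬ Multiple b w → F w ≡ + 0) →
                  ∀ w → ¬ Multiple b w → Δ k F w ≡ + 0
Δ-off-multiples _ a b F refl F-off w w∤ =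
  cong₂ _-_ (F-off (w - + (a ℕ.* b)) shifted∤) (F-off w w∤)
  where
  shifted∤ : ¬ Multiple b (w - + (a ℕ.* b))
  shifted∤ (β , e) = w∤ (β + + a , trans (unshift w (+ (a ℕ.* b))) (trans (cong (_+ + (a ℕ.* b)) e)
                                      (trans (cong (λ t → β * + b + t) (ℤP.pos-* a b)) (factor β (+ a) (+ b)))))
    where
    unshift : ∀ w k → w ≡ w - k + k
    unshift = solve-∀
    factor : ∀ β a b → β * b + a * b ≡ (β + a) * b
    factor = solve-∀

-- Iterating it three times yields the representations
-- n = x·qr + y·rp + z·pq + d·pqr (see Rep₃ below).  When every element of S is a multiple of b
-- and b ⊥ g, adding g to n changes the digit by one, which gives the periodicity properties of
-- the indicator of such a set.

data Digits (S : ℕ → Set) (g b n : ℕ) : Set where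
  digits : ∀ {s} z → S s → z ℕ.< b → n ≡ s ℕ.+ z ℕ.* g → Digits S g b n

module DigitsProperties (S : ℕ → Set) (g b : ℕ) (S⊆b∣ : ∀ {s} → S s → b ∣ s) (b⊥g : Coprime b g) where

  raise : ∀ {n s} z → n ≡ s ℕ.+ z ℕ.* g → n ℕ.+ g ≡ s ℕ.+ suc z ℕ.* g
  raise {s = s} z refl = regroup s z g
    where
    regroup : ∀ s z g → s ℕ.+ z ℕ.* g ℕ.+ g ≡ s ℕ.+ suc z ℕ.* g
    regroup = ℕSolver.solve-∀

  digit-divisible : ∀ z {s} → S s → b ∣ s ℕ.+ z ℕ.* g → b ∣ z
  digit-divisible z s∈S b∣ =
    coprime-divisor b⊥g (subst (b ∣_) (ℕP.*-comm z g) (ℕD.∣m+n∣m⇒∣n b∣ (S⊆b∣ s∈S)))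

  -- a represented multiple of b has digit 0, so it lies in S
  at-multiple : ∀ {n} → b ∣ n → Digits S g b n → S n
  at-multiple b∣n (digits zero    s∈S _   refl) = subst S (sym (ℕP.+-identityʳ _)) s∈S
  at-multiple b∣n (digits (suc z) s∈S z<b refl) =
    ⊥-elim (ℕP.<⇒≱ z<b (ℕD.∣⇒≤ (digit-divisible (suc z) s∈S b∣n)))

  base : ∀ {n} → 1 ℕ.≤ b → S n → Digits S g b n
  base {n} 1≤b n∈S = digits 0 n∈S 1≤b (sym (ℕP.+-identityʳ n))

  -- removing g lowers the digit, unless it was 0 (then n + g ∈ S is a multiple of b)
  step-down : ∀ n → Digits S g b (n ℕ.+ g) → b ∣ n ℕ.+ g ⊎ Digits S g b n
  step-down n (digits zero    s∈S _   e) = inj₁ (subst (b ∣_) (sym (trans e (ℕP.+-identityʳ _))) (S⊆b∣ s∈S))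
  step-down n (digits {s} (suc z) s∈S z<b e) =
    inj₂ (digits z s∈S (ℕP.<-trans (ℕP.n<1+n z) z<b) (ℕP.+-cancelʳ-≡ _ _ _ (trans e (sym (raise z refl)))))

  -- adding g raises the digit, unless it becomes b (then n + g is a multiple of b)
  step-up : ∀ n → Digits S g b n → b ∣ n ℕ.+ g ⊎ Digits S g b (n ℕ.+ g)
  step-up n (digits {s} z s∈S z<b e) with suc z ℕ.≟ b
  ... | yes refl =
    inj₁ (subst (b ∣_) (sym (raise z e)) (ℕD.∣m∣n⇒∣m+n (S⊆b∣ s∈S) (ℕD.∣m⇒∣m*n g ℕD.∣-refl)))
  ... | no 1+z≢b = inj₂ (digits (suc z) s∈S (ℕP.≤∧≢⇒< z<b 1+z≢b) (raise z e))

  step-invariant : ∀ n → ¬ b ∣ n ℕ.+ g →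
    (Digits S g b n → Digits S g b (n ℕ.+ g)) × (Digits S g b (n ℕ.+ g) → Digits S g b n)
  step-invariant n b∤ = up , down
    where
    up : Digits S g b n → Digits S g b (n ℕ.+ g)
    up d with step-up n d
    ... | inj₁ b∣ = ⊥-elim (b∤ b∣)
    ... | inj₂ d' = d'
    down : Digits S g b (n ℕ.+ g) → Digits S g b n
    down d with step-down n d
    ... | inj₁ b∣ = ⊥-elim (b∤ b∣)
    ... | inj₂ d' = d'

  -- below g only elements of S (hence multiples of b) are represented
  below-step : ∀ n → n ℕ.< g → ¬ b ∣ n → ¬ Digits S g b n
  below-step n n<g b∤n (digits zero    s∈S _ e) = b∤n (subst (b ∣_) (sym (trans e (ℕP.+-identityʳ _))) (S⊆b∣ s∈S))
  below-step n n<g b∤n (digits {s} (suc z) s∈S _ e) =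
    ℕP.<⇒≱ n<g (subst (g ℕ.≤_) (sym e) (ℕP.≤-trans (ℕP.m≤m+n g (z ℕ.* g)) (ℕP.m≤n+m _ s)))

  step-to-multiple : ∀ n → Digits S g b n → b ∣ n ℕ.+ g → b ℕ.* g ℕ.≤ n ℕ.+ g
  step-to-multiple n (digits {s} z s∈S _ e) b∣ =
    subst (b ℕ.* g ℕ.≤_) (sym (raise z e))
          (ℕP.≤-trans (ℕP.*-monoˡ-≤ g (ℕD.∣⇒≤ (digit-divisible (suc z) s∈S (subst (b ∣_) (raise z e) b∣))))
                      (ℕP.m≤n+m _ s))

record Indicator (P : ℕ → Set) (f : ℤ → ℤ) : Set where
  field
    negative : VanishesBelow f (+ 0)
    value    : ∀ n → (P n × f (+ n) ≡ + 1) ⊎ (¬ P n × f (+ n) ≡ + 0)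

module IndicatorProperties {P : ℕ → Set} {f : ℤ → ℤ} (ind : Indicator P f) where
  open Indicator ind public

  one-at : ∀ {n} → P n → f (+ n) ≡ + 1
  one-at {n} Pn with value n
  ... | inj₁ (_ , e)   = e
  ... | inj₂ (¬Pn , _) = ⊥-elim (¬Pn Pn)

  zero-at : ∀ {n} → ¬ P n → f (+ n) ≡ + 0
  zero-at {n} ¬Pn with value n
  ... | inj₁ (Pn , _) = ⊥-elim (¬Pn Pn)
  ... | inj₂ (_ , e)  = e

  equal-at : ∀ {m n} → (P m → P n) → (P n → P m) → f (+ m) ≡ f (+ n)
  equal-at {m} m⇒n n⇒m with value m
  ... | inj₁ (Pm , e)  = trans e (sym (one-at (m⇒n Pm)))
  ... | inj₂ (¬Pm , e) = trans e (sym (zero-at (λ Pn → ¬Pm (n⇒m Pn))))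

  zero-or-one : ∀ x → f x ≡ + 0 ⊎ f x ≡ + 1
  zero-or-one -[1+ n ] = inj₁ (negative _ -<+)
  zero-or-one (+ n) with value n
  ... | inj₁ (_ , e) = inj₂ e
  ... | inj₂ (_ , e) = inj₁ e

module DigitsIndicator (S : ℕ → Set) (g b : ℕ) (S⊆b∣ : ∀ {s} → S s → b ∣ s) (b⊥g : Coprime b g)
                       {f : ℤ → ℤ} (ind : Indicator (Digits S g b) f) where
  open DigitsProperties S g b S⊆b∣ b⊥g
  open IndicatorProperties ind

  periodic : ∀ w → ¬ Multiple b w → f (w - + g) ≡ f w
  periodic -[1+ n ] _  = trans (negative _ (minus-below g -<+)) (sym (negative _ -<+))
  periodic (+ n) w∤ with nat-minus n g
  ... | inj₁ (n<g , neg)     = trans (negative _ neg) (sym (zero-at (below-step n n<g (w∤ ∘′ nat-multiple))))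
  ... | inj₂ (j , g+j≡n , e) =
    trans (cong f e) (equal-at (subst (Digits S g b) j+g≡n ∘′ up) (down ∘′ subst (Digits S g b) (sym j+g≡n)))
    where
    j+g≡n : j ℕ.+ g ≡ n
    j+g≡n = trans (ℕP.+-comm j g) g+j≡n
    j+g∤ : ¬ b ∣ j ℕ.+ g
    j+g∤ b∣ = w∤ (nat-multiple (subst (b ∣_) j+g≡n b∣))
    up : Digits S g b j → Digits S g b (j ℕ.+ g)
    up = proj₁ (step-invariant j j+g∤)
    down : Digits S g b (j ℕ.+ g) → Digits S g b j
    down = proj₂ (step-invariant j j+g∤)

  before-multiple : 1 ℕ.≤ b → ∀ α → α * + b ℤ.< + (b ℕ.* g) → f (α * + b - + g) ≡ + 0
  before-multiple 1≤b -[1+ a ] _ = negative _ (minus-below g (negative-multiple a b 1≤b))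
  before-multiple 1≤b (+ a) ab<bg with nat-minus (a ℕ.* b) g
  ... | inj₁ (_ , neg) = trans (cong (λ t → f (t - + g)) (sym (ℤP.pos-* a b))) (negative _ neg)
  ... | inj₂ (j , g+j≡ab , e) =
    trans (cong (λ t → f (t - + g)) (sym (ℤP.pos-* a b))) (trans (cong f e) (zero-at unrepresented))
    where
    j+g≡ab : j ℕ.+ g ≡ a ℕ.* b
    j+g≡ab = trans (ℕP.+-comm j g) g+j≡ab
    ab<bg' : a ℕ.* b ℕ.< b ℕ.* g
    ab<bg' = ℤP.drop‿+<+ (subst (ℤ._< + (b ℕ.* g)) (sym (ℤP.pos-* a b)) ab<bg)
    unrepresented : ¬ Digits S g b j
    unrepresented d = ℕP.<⇒≱ ab<bg'
      (subst (b ℕ.* g ℕ.≤_) j+g≡ab (step-to-multiple j d (subst (b ∣_) (sym j+g≡ab) (ℕD.n∣m*n a))))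

-- Representability as three nested one-digit extensions:
--   Rep₁ t  ⇔  t = c·pq + x·q        with x < p,
--   Rep₂ α  ⇔  α = t + y·p           with Rep₁ t, y < q,
--   Rep₃ n  ⇔  n = α·r + z·pq        with Rep₂ α, z < r,
-- so that Rep₃ n ⇔ n = x·qr + y·rp + z·pq + c·pqr, the representability of the paper.

Rep₁ : ℕ → ℕ → ℕ → Set
Rep₁ p q = Digits (p ℕ.* q ∣_) q p

Rep₂ : ℕ → ℕ → ℕ → Set
Rep₂ p q = Digits (Rep₁ p q) p q

Scaled : ℕ → (ℕ → Set) → ℕ → Set
Scaled r A s = Σ ℕ λ α → s ≡ α ℕ.* r × A α

Rep₃ : ℕ → ℕ → ℕ → ℕ → Set
Rep₃ p q r = Digits (Scaled r (Rep₂ p q)) (p ℕ.* q) r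

Rep₁⊆q∣ : ∀ p q {t} → Rep₁ p q t → q ∣ t
Rep₁⊆q∣ p q (digits x pq∣s _ refl) = ℕD.∣m∣n⇒∣m+n (ℕD.∣-trans (ℕD.n∣m*n p) pq∣s) (ℕD.n∣m*n x)

Scaled⊆r∣ : ∀ r A {s} → Scaled r A s → r ∣ s
Scaled⊆r∣ r A (α , refl , _) = ℕD.n∣m*n α

-- the boolean search in representableᵇ finds exactly the Rep₃-representations
any-upTo⁻ : ∀ (f : ℕ → Bool) m → T (any f (upTo m)) → Σ ℕ λ x → x ℕ.< m × T (f x)
any-upTo⁻ f m found with find (any⁻ f (upTo m) found)
... | x , x∈ , fx = x , ∈-upTo⁻ x∈ , fx

any-upTo⁺ : ∀ (f : ℕ → Bool) m x → x ℕ.< m → T (f x) → T (any f (upTo m))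
any-upTo⁺ f m x x<m fx = any⁺ f (lose (∈-upTo⁺ x<m) fx)

nested-digits : ∀ x y z c p q r →
  x ℕ.* q ℕ.* r ℕ.+ y ℕ.* r ℕ.* p ℕ.+ z ℕ.* p ℕ.* q ℕ.+ c ℕ.* p ℕ.* q ℕ.* r
    ≡ (c ℕ.* (p ℕ.* q) ℕ.+ x ℕ.* q ℕ.+ y ℕ.* p) ℕ.* r ℕ.+ z ℕ.* (p ℕ.* q)
nested-digits = ℕSolver.solve-∀

representableᵇ-sound : ∀ p q r n → T (representableᵇ p q r (+ n)) → Rep₃ p q r n
representableᵇ-sound p q r n found with any-upTo⁻ _ p found
... | x , x<p , found₁ with any-upTo⁻ _ q found₁
... | y , y<q , found₂ with any-upTo⁻ _ r found₂
... | z , z<r , found₃ with any-upTo⁻ _ (suc n) found₃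
... | c , _   , found₄ =
  digits z (α , refl , digits y (digits x (divides c refl) x<p refl) y<q refl) z<r
         (trans (sym (ℕP.≡ᵇ⇒≡ _ _ found₄)) (nested-digits x y z c p q r))
  where
  α : ℕ
  α = c ℕ.* (p ℕ.* q) ℕ.+ x ℕ.* q ℕ.+ y ℕ.* p

representableᵇ-complete : ∀ p q r n → 1 ℕ.≤ p ℕ.* q ℕ.* r → Rep₃ p q r n → T (representableᵇ p q r (+ n))
representableᵇ-complete p q r n 1≤pqr
    (digits z (_ , refl , digits y (digits x (divides c refl) x<p refl) y<q refl) z<r refl) =
  any-upTo⁺ _ p x x<p (any-upTo⁺ _ q y y<q (any-upTo⁺ _ r z z<r
    (any-upTo⁺ _ (suc n) c (s≤s c≤n) (ℕP.≡⇒≡ᵇ _ _ (nested-digits x y z c p q r)))))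
  where
  c≤n : c ℕ.≤ _
  c≤n = begin
    c                                                                ≤⟨ ℕP.m≤m*n c (p ℕ.* q ℕ.* r) {{ℕ.>-nonZero 1≤pqr}} ⟩
    c ℕ.* (p ℕ.* q ℕ.* r)                                            ≡⟨ reassoc c p q r ⟩
    c ℕ.* p ℕ.* q ℕ.* r                                              ≤⟨ ℕP.m≤n+m _ (x ℕ.* q ℕ.* r ℕ.+ y ℕ.* r ℕ.* p ℕ.+ z ℕ.* p ℕ.* q) ⟩
    x ℕ.* q ℕ.* r ℕ.+ y ℕ.* r ℕ.* p ℕ.+ z ℕ.* p ℕ.* q ℕ.+ c ℕ.* p ℕ.* q ℕ.* r ≡⟨ nested-digits x y z c p q r ⟩
    (c ℕ.* (p ℕ.* q) ℕ.+ x ℕ.* q ℕ.+ y ℕ.* p) ℕ.* r ℕ.+ z ℕ.* (p ℕ.* q) ∎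
    where
    open ℕP.≤-Reasoning
    reassoc : ∀ c p q r → c ℕ.* (p ℕ.* q ℕ.* r) ≡ c ℕ.* p ℕ.* q ℕ.* r
    reassoc = ℕSolver.solve-∀

χ-indicator : ∀ p q r → 1 ℕ.≤ p ℕ.* q ℕ.* r → Indicator (Rep₃ p q r) (χ p q r)
χ-indicator p q r 1≤pqr = record { negative = negative ; value = value }
  where
  negative : VanishesBelow (χ p q r) (+ 0)
  negative -[1+ n ] _        = refl
  negative (+ n)    (+<+ ())
  value : ∀ n → (Rep₃ p q r n × χ p q r (+ n) ≡ + 1) ⊎ (¬ Rep₃ p q r n × χ p q r (+ n) ≡ + 0)
  value n with representableᵇ p q r (+ n) in found
  ... | true  = inj₁ (representableᵇ-sound p q r n (subst T (sym found) tt) , refl)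
  ... | false = inj₂ ((λ rep → subst T found (representableᵇ-complete p q r n 1≤pqr rep)) , refl)

module Representability (p q r : ℕ) (1≤p : 1 ℕ.≤ p) (1≤q : 1 ℕ.≤ q) (1≤r : 1 ℕ.≤ r)
                        (p⊥q : Coprime p q) (r⊥pq : Coprime r (p ℕ.* q)) where

  R : ℤ
  R = + r

  ψ : ℤ → ℤ
  ψ α = χ p q r (α * R)

  1≤pqr : 1 ℕ.≤ p ℕ.* q ℕ.* r
  1≤pqr = ℕP.*-mono-≤ (ℕP.*-mono-≤ 1≤p 1≤q) 1≤r

  module Level₃ = DigitsProperties (Scaled r (Rep₂ p q)) (p ℕ.* q) r (Scaled⊆r∣ r (Rep₂ p q)) r⊥pq
  module Level₂ = DigitsProperties (Rep₁ p q) p q (Rep₁⊆q∣ p q) (Coprimality.sym p⊥q)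
  module χ-Ind = IndicatorProperties (χ-indicator p q r 1≤pqr)

  ψ-indicator : Indicator (Rep₂ p q) ψ
  ψ-indicator = record { negative = negative ; value = value }
    where
    negative : VanishesBelow ψ (+ 0)
    negative -[1+ a ] _        = χ-Ind.negative _ (negative-multiple a r 1≤r)
    negative (+ a)    (+<+ ())
    from-Rep₃ : ∀ {a} → Rep₃ p q r (a ℕ.* r) → Rep₂ p q a
    from-Rep₃ {a} rep with Level₃.at-multiple (ℕD.n∣m*n a) rep
    ... | α , ar≡αr , α∈ = subst (Rep₂ p q) (sym (ℕP.*-cancelʳ-≡ a α r {{ℕ.>-nonZero 1≤r}} ar≡αr)) α∈
    value : ∀ a → (Rep₂ p q a × ψ (+ a) ≡ + 1) ⊎ (¬ Rep₂ p q a × ψ (+ a) ≡ + 0)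
    value a rewrite sym (ℤP.pos-* a r) with χ-Ind.value (a ℕ.* r)
    ... | inj₁ (rep , e)  = inj₁ (from-Rep₃ rep , e)
    ... | inj₂ (¬rep , e) = inj₂ ((λ a∈ → ¬rep (Level₃.base 1≤r (a , refl , a∈))) , e)

  module χ-Digits = DigitsIndicator (Scaled r (Rep₂ p q)) (p ℕ.* q) r (Scaled⊆r∣ r (Rep₂ p q)) r⊥pq
                                    (χ-indicator p q r 1≤pqr)
  module ψ-Digits = DigitsIndicator (Rep₁ p q) p q (Rep₁⊆q∣ p q) (Coprimality.sym p⊥q) ψ-indicator
  module ψ-Ind = IndicatorProperties ψ-indicator

  Q : ℤ
  Q = + q

  -- the multiples βq with 0 ≤ β < p are 2-representable (x = β, all other digits 0)
  q-multiple-represented : ∀ β → β ℕ.< p → Rep₂ p q (β ℕ.* q)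
  q-multiple-represented β β<p = Level₂.base 1≤q (digits β (ℕD._∣0 (p ℕ.* q)) β<p refl)

  -- hence along the multiples βq with β < p, ψ is the step function [β ≥ 0]
  ψ-along-q : ∀ β → β ℤ.< + p → Δ 1 (λ γ → ψ (γ * Q)) β ≡ - δ β
  ψ-along-q -[1+ b ]  _ = cong₂ _-_ (ψ-Ind.negative _ (negative-multiple (suc (b ℕ.+ 0)) q 1≤q))
                                    (ψ-Ind.negative _ (negative-multiple b q 1≤q))
  ψ-along-q (+ zero)  _ = cong₂ _-_ (ψ-Ind.negative _ (negative-multiple 0 q 1≤q))
                                    (ψ-Ind.one-at (q-multiple-represented 0 1≤p))
  ψ-along-q (+ suc b) 1+b<p =
    cong₂ _-_ (trans (cong ψ (sym (ℤP.pos-* b q))) (ψ-Ind.one-at (q-multiple-represented b b<p)))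
              (trans (cong ψ (sym (ℤP.pos-* (suc b) q)))
                     (ψ-Ind.one-at (q-multiple-represented (suc b) (ℤP.drop‿+<+ 1+b<p))))
    where
    b<p : b ℕ.< p
    b<p = ℕP.<-trans (ℕP.n<1+n b) (ℤP.drop‿+<+ 1+b<p)

  Δψ-off : ∀ w → ¬ Multiple q w → Δ p ψ w ≡ + 0
  Δψ-off w w∤ = trans (cong (_- ψ w) (ψ-Digits.periodic w w∤)) (ℤP.+-inverseʳ (ψ w))

  Δψ-on : ∀ β → β ℤ.< + p → Δ p ψ (β * Q) ≡ - ψ (β * Q)
  Δψ-on β β<p = Δ-from-zero p {ψ} {β * Q}
    (ψ-Digits.before-multiple 1≤q β (subst (β * Q ℤ.<_) (cong +_ (ℕP.*-comm p q)) (scale-< p q 1≤q β<p)))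

  -- Δ_p Δ_q ψ = δ below pq: the two-generator identity for the semigroup ⟨p, q⟩
  ψ-difference : ∀ α → α ℤ.< + (p ℕ.* q) → Δ p (Δ q ψ) α ≡ δ α
  ψ-difference α α<pq = trans (Δ-comm p q ψ α) (by-cases (multiple? q α))
    where
    q≡1·q : q ≡ 1 ℕ.* q
    q≡1·q = sym (ℕP.*-identityˡ q)
    by-cases : Multiple q α ⊎ ¬ Multiple q α → Δ q (Δ p ψ) α ≡ δ α
    by-cases (inj₂ α∤) = trans (Δ-off-multiples q 1 q (Δ p ψ) q≡1·q Δψ-off α α∤)
                               (sym (δ-nonzero α (λ α≡0 → α∤ (+ 0 , α≡0))))
    by-cases (inj₁ (β , refl)) = begin
      Δ q (Δ p ψ) (β * Q)              ≡⟨ Δ-on-multiples q 1 q (Δ p ψ) q≡1·q β ⟩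
      Δ 1 (λ γ → Δ p ψ (γ * Q)) β      ≡⟨ Δ*-agree (1 ∷ []) Δψ-on β β<p ⟩
      Δ 1 (λ γ → - ψ (γ * Q)) β        ≡⟨ Δ*-neg (1 ∷ []) (λ γ → ψ (γ * Q)) β ⟩
      - Δ 1 (λ γ → ψ (γ * Q)) β        ≡⟨ cong -_ (ψ-along-q β β<p) ⟩
      - - δ β                          ≡⟨ ℤP.neg-involutive (δ β) ⟩
      δ β                              ≡⟨ δ-multiple β q 1≤q ⟨
      δ (β * Q)                        ∎
      where
      open ≡-Reasoning
      β<p : β ℤ.< + p
      β<p = unscale-< p q α<pq

  Δχ-off : ∀ w → ¬ Multiple r w → Δ (p ℕ.* q) (χ p q r) w ≡ + 0
  Δχ-off w w∤ = trans (cong (_- χ p q r w) (χ-Digits.periodic w w∤)) (ℤP.+-inverseʳ (χ p q r w))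

  Δχ-on : ∀ α → α ℤ.< + (p ℕ.* q) → Δ (p ℕ.* q) (χ p q r) (α * R) ≡ - ψ α
  Δχ-on α α<pq = Δ-from-zero (p ℕ.* q) {χ p q r} {α * R}
    (χ-Digits.before-multiple 1≤r α
      (subst (α * R ℤ.<_) (cong +_ (ℕP.*-comm (p ℕ.* q) r)) (scale-< (p ℕ.* q) r 1≤r α<pq)))

  χ-difference : ∀ y → y ℤ.< + (p ℕ.* q ℕ.* r) →
                 Δ* (r ℕ.* p ∷ q ℕ.* r ∷ p ℕ.* q ∷ []) (χ p q r) y ≡ - δ y
  χ-difference y y<pqr = by-cases (multiple? r y)
    where
    H : ℤ → ℤ
    H = Δ (p ℕ.* q) (χ p q r)
    by-cases : Multiple r y ⊎ ¬ Multiple r y → Δ (r ℕ.* p) (Δ (q ℕ.* r) H) y ≡ - δ y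
    by-cases (inj₂ y∤) =
      trans (Δ-off-multiples (r ℕ.* p) p r (Δ (q ℕ.* r) H) (ℕP.*-comm r p)
                             (Δ-off-multiples (q ℕ.* r) q r H refl Δχ-off) y y∤)
            (sym (cong -_ (δ-nonzero y (λ y≡0 → y∤ (+ 0 , y≡0)))))
    by-cases (inj₁ (α , refl)) = begin
      Δ (r ℕ.* p) (Δ (q ℕ.* r) H) (α * R)   ≡⟨ Δ-on-multiples (r ℕ.* p) p r (Δ (q ℕ.* r) H) (ℕP.*-comm r p) α ⟩
      Δ p (λ β → Δ (q ℕ.* r) H (β * R)) α   ≡⟨ Δ-cong p (Δ-on-multiples (q ℕ.* r) q r H refl) α ⟩
      Δ p (Δ q (λ β → H (β * R))) α         ≡⟨ Δ*-agree (p ∷ q ∷ []) Δχ-on α α<pq ⟩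
      Δ p (Δ q (λ β → - ψ β)) α             ≡⟨ Δ*-neg (p ∷ q ∷ []) ψ α ⟩
      - Δ p (Δ q ψ) α                       ≡⟨ cong -_ (ψ-difference α α<pq) ⟩
      - δ α                                 ≡⟨ cong -_ (δ-multiple α r 1≤r) ⟨
      - δ (α * R)                           ∎
      where
      open ≡-Reasoning
      α<pq : α ℤ.< + (p ℕ.* q)
      α<pq = unscale-< (p ℕ.* q) r y<pqr

-- Window sums  window k F y = Σ_{y-k < n ≤ y} F n,  so that σ_k = window k χ.

window : ℕ → (ℤ → ℤ) → ℤ → ℤ
window k F y = sumBelow k (λ i → F (y - + i))

-- two ways of splitting one sum give an identity between differences
exchange : ∀ a b c d → a + d ≡ c + b → a - b ≡ c - d
exchange a b c d a+d≡c+b = begin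
  a - b          ≡⟨ pad a b d ⟩
  a + d - b - d  ≡⟨ cong (λ t → t - b - d) a+d≡c+b ⟩
  c + b - b - d  ≡⟨ unpad c b d ⟩
  c - d          ∎
  where
  open ≡-Reasoning
  pad : ∀ a b d → a - b ≡ a + d - b - d
  pad = solve-∀
  unpad : ∀ c b d → c + b - b - d ≡ c - d
  unpad = solve-∀

window-+ : ∀ a b F y → window (a ℕ.+ b) F y ≡ window a F y + window b F (y - + a)
window-+ a b F y =
  trans (sumBelow-+ a b (λ i → F (y - + i)))
        (cong (λ t → window a F y + t) (sumBelow-cong b (λ i _ → cong F (split-step y (+ a) (+ i)))))
  where
  split-step : ∀ y a i → y - (a + i) ≡ y - a - i
  split-step = solve-∀

window-Δ1 : ∀ k F y → Δ 1 (window k F) y ≡ Δ k F y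
window-Δ1 k F y = exchange (window k F (y - + 1)) (window k F y) (F (y - + k)) (F y) (begin
  window k F (y - + 1) + F y           ≡⟨ ℤP.+-comm _ (F y) ⟩
  F y + window k F (y - + 1)           ≡⟨ cong (_+ window k F (y - + 1)) first-term ⟩
  window 1 F y + window k F (y - + 1)  ≡⟨ window-+ 1 k F y ⟨
  window (suc k) F y                   ≡⟨ ℤP.+-comm (window k F y) _ ⟩
  F (y - + k) + window k F y           ∎)
  where
  open ≡-Reasoning
  first-term : F y ≡ window 1 F y
  first-term = trans (cong F (sym (ℤP.+-identityʳ y))) (sym (ℤP.+-identityˡ _))

window-swap : ∀ N c F y → window N F y - window N F (y - + c) ≡ window c F y - window c F (y - + N)
window-swap N c F y = exchange (window N F y) (window N F (y - + c)) (window c F y) (window c F (y - + N)) (begin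
  window N F y + window c F (y - + N)  ≡⟨ window-+ N c F y ⟨
  window (N ℕ.+ c) F y                 ≡⟨ cong (λ t → window t F y) (ℕP.+-comm N c) ⟩
  window (c ℕ.+ N) F y                 ≡⟨ window-+ c N F y ⟩
  window c F y + window N F (y - + c)  ∎)
  where open ≡-Reasoning

window-shift-diff : ∀ k c F y → window k F y - window k F (y - + c) ≡ window k (λ w → F w - F (w - + c)) y
window-shift-diff k c F y = sym (trans
  (sumBelow-cong k (λ i _ → cong (λ t → F (y - + i) - F t) (swap-steps y (+ i) (+ c))))
  (sumBelow-- k (λ i → F (y - + i)) (λ i → F (y - + c - + i))))
  where
  swap-steps : ∀ y i c → y - i - c ≡ y - c - i
  swap-steps = solve-∀

window-point : ∀ y {i k} → i ℕ.< k → (y - + i) ∈⟨ y - + k , y ]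
window-point y i<k = ℤP.+-monoʳ-< y (ℤP.neg-mono-< (ℤ.+<+ i<k)) , minus-≤ y _

window-index : ∀ y {i k} → y - + k ℤ.< y - + i → i ℕ.< k
window-index y {i} {k} y-k<y-i with ℕP.<-≤-connex i k
... | inj₁ i<k = i<k
... | inj₂ k≤i = ⊥-elim (ℤP.<⇒≱ y-k<y-i (ℤP.+-monoʳ-≤ y (ℤP.neg-mono-≤ (ℤ.+≤+ k≤i))))

multiples-apart : ∀ {k b y α β} → k ℕ.≤ b → y - + k ℤ.< α * + b → β * + b ℤ.≤ y → ¬ (α ℤ.< β)
multiples-apart {k} {b} {y} {α} {β} k≤b y-k<αb βb≤y α<β = ℤP.<-irrefl refl (begin-strict
  y                ≡⟨ unshift y (+ k) ⟩
  y - + k + + k    <⟨ ℤP.+-monoˡ-< (+ k) y-k<αb ⟩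
  α * + b + + k    ≤⟨ ℤP.+-monoʳ-≤ (α * + b) (ℤ.+≤+ k≤b) ⟩
  α * + b + + b    ≡⟨ next-multiple α (+ b) ⟩
  (α + + 1) * + b  ≤⟨ ℤP.*-monoʳ-≤-nonNeg (+ b) (subst (ℤ._≤ β) (ℤP.+-comm (+ 1) α) (ℤP.i<j⇒suc[i]≤j α<β)) ⟩
  β * + b          ≤⟨ βb≤y ⟩
  y                ∎)
  where
  open ℤP.≤-Reasoning
  unshift : ∀ y k → y ≡ y - k + k
  unshift = solve-∀
  next-multiple : ∀ α b → α * b + b ≡ (α + + 1) * b
  next-multiple = solve-∀

at-most-one-multiple : ∀ {k b y α β} → k ℕ.≤ b →
  (α * + b) ∈⟨ y - + k , y ] → (β * + b) ∈⟨ y - + k , y ] → α ≡ β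
at-most-one-multiple {α = α} {β} k≤b (y-k<αb , αb≤y) (y-k<βb , βb≤y) with ℤP.<-cmp α β
... | tri< α<β _ _ = ⊥-elim (multiples-apart k≤b y-k<αb βb≤y α<β)
... | tri≈ _ α≡β _ = α≡β
... | tri> _ _ β<α = ⊥-elim (multiples-apart k≤b y-k<βb αb≤y β<α)

window-offset : ∀ {x y} → x ℤ.≤ y → Σ ℕ λ i → y - + i ≡ x
window-offset {x} {y} x≤y =
  ℤ.∣ y - x ∣ , trans (cong (λ t → y - t) (ℤP.0≤i⇒+∣i∣≡i (ℤP.i≤j⇒0≤j-i x≤y))) (back y x)
  where
  back : ∀ y x → y - (y - x) ≡ x
  back = solve-∀

window-offset-injective : ∀ y {i j} → y - + i ≡ y - + j → i ≡ j
window-offset-injective y {i} {j} e =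
  ℤP.+-injective (trans (recover y (+ i)) (trans (cong (λ t → y - t) e) (sym (recover y (+ j)))))
  where
  recover : ∀ y i → i ≡ y - (y - i)
  recover = solve-∀

window-no-multiple : ∀ k b F y → (∀ w → ¬ Multiple b w → F w ≡ + 0) →
  (∀ α → ¬ (α * + b) ∈⟨ y - + k , y ]) → window k F y ≡ + 0
window-no-multiple k b F y F-off none = sumBelow-zero k (λ i i<k → F-off _ (λ (α , e) →
  none α (subst (_∈⟨ y - + k , y ]) e (window-point y i<k))))

window-one-multiple : ∀ k b F y α → k ℕ.≤ b → (∀ w → ¬ Multiple b w → F w ≡ + 0) →
  (α * + b) ∈⟨ y - + k , y ] → window k F y ≡ F (α * + b)
window-one-multiple k b F y α k≤b F-off αb∈@(y-k<αb , αb≤y) with window-offset αb≤y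
... | i₀ , y-i₀≡αb =
  trans (sumBelow-single k (λ i → F (y - + i)) i₀ i₀<k others) (cong F y-i₀≡αb)
  where
  i₀<k : i₀ ℕ.< k
  i₀<k = window-index y (subst (y - + k ℤ.<_) (sym y-i₀≡αb) y-k<αb)
  others : ∀ i → i ℕ.< k → i ≢ i₀ → F (y - + i) ≡ + 0
  others i i<k i≢i₀ with multiple? b (y - + i)
  ... | inj₂ y-i∤ = F-off _ y-i∤
  ... | inj₁ (β , y-i≡βb) = ⊥-elim (i≢i₀ (window-offset-injective y (begin
    y - + i  ≡⟨ y-i≡βb ⟩
    β * + b  ≡⟨ cong (_* + b) (at-most-one-multiple {α = β} {α} k≤b βb∈ αb∈) ⟩
    α * + b  ≡⟨ y-i₀≡αb ⟨
    y - + i₀ ∎)))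
    where
    open ≡-Reasoning
    βb∈ : (β * + b) ∈⟨ y - + k , y ]
    βb∈ = subst (_∈⟨ y - + k , y ]) y-i≡βb (window-point y i<k)

cross : ℕ → ℕ → (ℤ → ℤ) → ℤ → ℤ
cross p q F x = F x - F (x - + p) - F (x - + q) + F (x - + q - + p)

cross≡Δ : ∀ p q F x → cross p q F x ≡ Δ p (Δ q F) x
cross≡Δ p q F x =
  trans (cong (λ t → F x - F (x - + p) - F (x - + q) + F t) (swap-steps x (+ q) (+ p)))
        (regroup (F x) (F (x - + p)) (F (x - + q)) (F (x - + p - + q)))
  where
  swap-steps : ∀ x q p → x - q - p ≡ x - p - q
  swap-steps = solve-∀
  regroup : ∀ a b c d → a - b - c + d ≡ d - b - (c - a)
  regroup = solve-∀

cross-cong : ∀ p q {F H : ℤ → ℤ} → F ≗ H → cross p q F ≗ cross p q H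
cross-cong p q F≗H x =
  cong₂ _+_ (cong₂ _-_ (cong₂ _-_ (F≗H x) (F≗H (x - + p))) (F≗H (x - + q))) (F≗H (x - + q - + p))

cross-+ : ∀ p q F H x → cross p q (λ z → F z + H z) x ≡ cross p q F x + cross p q H x
cross-+ p q F H x = regroup (F x) (F (x - + p)) (F (x - + q)) (F (x - + q - + p))
                            (H x) (H (x - + p)) (H (x - + q)) (H (x - + q - + p))
  where
  regroup : ∀ a b c d a' b' c' d' →
    a + a' - (b + b') - (c + c') + (d + d') ≡ (a - b - c + d) + (a' - b' - c' + d')
  regroup = solve-∀

cross-shift : ∀ p q F c x → cross p q (λ z → F (z - + c)) x ≡ cross p q F (x - + c)
cross-shift p q F c x =
  cong₂ _+_ (cong₂ _-_ (cong₂ _-_ (refl {x = F (x - + c)}) (cong F (swap-steps x (+ p) (+ c))))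
                       (cong F (swap-steps x (+ q) (+ c))))
            (cong F (trans (swap-steps (x - + q) (+ p) (+ c)) (cong (_- + p) (swap-steps x (+ q) (+ c)))))
  where
  swap-steps : ∀ x a c → x - a - c ≡ x - c - a
  swap-steps = solve-∀

cross-as-differences : ∀ p q F x → cross p q F x ≡ (F x - F (x - + p)) - (F (x - + q) - F (x - + q - + p))
cross-as-differences p q F x = regroup (F x) (F (x - + p)) (F (x - + q)) (F (x - + q - + p))
  where
  regroup : ∀ a b c d → a - b - c + d ≡ (a - b) - (c - d)
  regroup = solve-∀

-- Both sides vanish for m < 0, and below pqr they have the same Δ*[1, rp, qr, pq]:
-- for the left side this is the difference equation of Q, for the right side it follows from
-- Δ_1 σ_r = Δ_r χ and the difference equation of χ.
module CoefficientFormula (p q r : ℕ) (1≤p : 1 ℕ.≤ p) (1≤q : 1 ℕ.≤ q) (1≤r : 1 ℕ.≤ r)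
                          (p⊥q : Coprime p q) (r⊥pq : Coprime r (p ℕ.* q)) where
  open Representability p q r 1≤p 1≤q 1≤r p⊥q r⊥pq using (χ-difference; module χ-Ind)

  σᵣ : ℤ → ℤ
  σᵣ = σ p q r r

  ks : List ℕ
  ks = 1 ∷ r ℕ.* p ∷ q ℕ.* r ∷ p ℕ.* q ∷ []

  σᵣ-difference : ∀ x → x ℤ.< + (p ℕ.* q ℕ.* r) →
                  Δ* ks (Δ* (p ∷ q ∷ []) σᵣ) x ≡ - Δ* (p ∷ q ∷ r ∷ []) δ x
  σᵣ-difference x x<pqr = begin
    Δ* (ks ++ p ∷ q ∷ []) σᵣ x                      ≡⟨ Δ*-perm σᵣ (Perm.trans (shifts ks (p ∷ q ∷ []) {[]})
                                                          (prep p (prep q (shifts (1 ∷ []) ls {[]})))) x ⟩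
    Δ* outer (Δ 1 σᵣ) x                             ≡⟨ Δ*-cong outer (window-Δ1 r (χ p q r)) x ⟩
    Δ* outer (Δ r (χ p q r)) x                      ≡⟨ Δ*-perm (χ p q r) (prep p (prep q (shifts ls (r ∷ []) {[]}))) x ⟩
    Δ* (p ∷ q ∷ r ∷ []) (Δ* ls (χ p q r)) x         ≡⟨ Δ*-agree (p ∷ q ∷ r ∷ []) χ-difference x x<pqr ⟩
    Δ* (p ∷ q ∷ r ∷ []) (λ y → - δ y) x             ≡⟨ Δ*-neg (p ∷ q ∷ r ∷ []) δ x ⟩
    - Δ* (p ∷ q ∷ r ∷ []) δ x                       ∎
    where
    open ≡-Reasoning
    ls outer : List ℕ
    ls    = r ℕ.* p ∷ q ℕ.* r ∷ p ℕ.* q ∷ []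
    outer = p ∷ q ∷ ls

  coefficient-formula : ∀ x → x ℤ.< + (p ℕ.* q ℕ.* r) → coeffQ p q r x ≡ cross p q σᵣ x
  coefficient-formula x x<pqr =
    trans (Δ*-uniqueness ks (+ (p ℕ.* q ℕ.* r)) (coeffQ p q r) (Δ* (p ∷ q ∷ []) σᵣ) steps-positive
                         negatives differences x x<pqr)
          (sym (cross≡Δ p q σᵣ x))
    where
    steps-positive : All (1 ℕ.≤_) ks
    steps-positive = ℕP.≤-refl ∷ ℕP.*-mono-≤ 1≤r 1≤p ∷ ℕP.*-mono-≤ 1≤q 1≤r ∷ ℕP.*-mono-≤ 1≤p 1≤q ∷ []
    σᵣ-negative : VanishesBelow σᵣ (+ 0)
    σᵣ-negative y y<0 = sumBelow-zero r (λ i _ → χ-Ind.negative _ (minus-below i y<0))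
    negatives : ∀ y → y ℤ.< + 0 → coeffQ p q r y ≡ Δ* (p ∷ q ∷ []) σᵣ y
    negatives y y<0 = trans (trans (coeffQ≗ext p q r y) (ext-vanishes (Qseries p q r) y y<0))
                            (sym (Δ*-vanishes (p ∷ q ∷ []) σᵣ-negative y y<0))
    differences : ∀ y → y ℤ.< + (p ℕ.* q ℕ.* r) → Δ* ks (coeffQ p q r) y ≡ Δ* ks (Δ* (p ∷ q ∷ []) σᵣ) y
    differences y y<pqr = trans (coeffQ-difference p q r 1≤p 1≤q 1≤r y y<pqr) (sym (σᵣ-difference y y<pqr))

-- Lemma 7.  With r = pq + s and y = m - s, splitting the window of σ_r into the window of σ_s
-- and a window of length pq gives  a_m = Σ₁ + W(y) - W(y - q),  where W is a window sum of
-- length p of G(w) = χ(w) - χ(w - pq).  G vanishes off the multiples of r and G(αr) = χ(αr),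
-- so W(y) and W(y - q) pick up χ at the (at most one) multiple of r in I₂ resp. I₁.
module Lemma7 (p q s : ℕ) (3≤p : 3 ℕ.≤ p) (p<q : p ℕ.< q) (p⊥q : Coprime p q)
              (1≤s : 1 ℕ.≤ s) (s⊥pq : Coprime s (p ℕ.* q))
              (m : ℤ) (m<pqr : m ℤ.< + (p ℕ.* q ℕ.* (p ℕ.* q ℕ.+ s))) where

  r : ℕ
  r = p ℕ.* q ℕ.+ s
  P Q S R y : ℤ
  P = + p
  Q = + q
  S = + s
  R = + r
  y = m - S

  1≤p : 1 ℕ.≤ p
  1≤p = ℕP.≤-trans (s≤s z≤n) 3≤p
  1≤q : 1 ℕ.≤ q
  1≤q = ℕP.≤-trans 1≤p (ℕP.<⇒≤ p<q)
  1≤r : 1 ℕ.≤ r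
  1≤r = ℕP.≤-trans 1≤s (ℕP.m≤n+m s (p ℕ.* q))

  -- q + p < 2q ≤ 3q ≤ pq ≤ r, so both windows and their union are shorter than r
  q+p≤r : q ℕ.+ p ℕ.≤ r
  q+p≤r = ℕP.≤-trans (ℕP.<⇒≤ (ℕP.+-monoʳ-< q p<q))
            (ℕP.≤-trans (ℕP.+-monoʳ-≤ q (ℕP.m≤m+n q (q ℕ.+ 0)))
            (ℕP.≤-trans (ℕP.*-monoˡ-≤ q 3≤p) (ℕP.m≤m+n (p ℕ.* q) s)))
  p≤r : p ℕ.≤ r
  p≤r = ℕP.≤-trans (ℕP.m≤n+m p q) q+p≤r

  open Representability p q r 1≤p 1≤q 1≤r p⊥q (coprime-+ s⊥pq) using (module χ-Digits; module χ-Ind)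
  open CoefficientFormula p q r 1≤p 1≤q 1≤r p⊥q (coprime-+ s⊥pq) using (coefficient-formula)

  G : ℤ → ℤ
  G w = χ p q r w - χ p q r (w - + (p ℕ.* q))

  G-off : ∀ w → ¬ Multiple r w → G w ≡ + 0
  G-off w w∤ = trans (cong (λ t → χ p q r w - t) (χ-Digits.periodic w w∤)) (ℤP.+-inverseʳ (χ p q r w))

  G-on : ∀ α → α * R ℤ.≤ y → G (α * R) ≡ χ p q r (α * R)
  G-on α αr≤y = trans (cong (λ t → χ p q r (α * R) - t) (χ-Digits.before-multiple 1≤r α αr<rpq)) (ℤP.+-identityʳ _)
    where
    αr<rpq : α * R ℤ.< + (r ℕ.* (p ℕ.* q))
    αr<rpq = subst (α * R ℤ.<_) (cong +_ (ℕP.*-comm (p ℕ.* q) r))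
                   (ℤP.≤-<-trans (ℤP.≤-trans αr≤y (minus-≤ m s)) m<pqr)

  Σ₁ : ℤ
  Σ₁ = cross p q (σ p q r s) m

  -- the window of length pq left over when σ_r is cut down to σ_s
  V : ℤ → ℤ
  V = window (p ℕ.* q) (χ p q r)

  σᵣ-split : ∀ x → σ p q r r x ≡ σ p q r s x + V (x - S)
  σᵣ-split x = trans (cong (λ t → window t (χ p q r) x) (ℕP.+-comm (p ℕ.* q) s)) (window-+ s (p ℕ.* q) (χ p q r) x)

  V-step : ∀ z → V z - V (z - P) ≡ window p G z
  V-step z = trans (window-swap (p ℕ.* q) p (χ p q r) z) (window-shift-diff p (p ℕ.* q) (χ p q r) z)

  decomposition : coeffQ p q r m ≡ Σ₁ + (window p G y - window p G (y - Q))
  decomposition = begin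
    coeffQ p q r m                                        ≡⟨ coefficient-formula m m<pqr ⟩
    cross p q (σ p q r r) m                               ≡⟨ cross-cong p q σᵣ-split m ⟩
    cross p q (λ x → σ p q r s x + V (x - S)) m           ≡⟨ cross-+ p q (σ p q r s) (λ x → V (x - S)) m ⟩
    Σ₁ + cross p q (λ x → V (x - S)) m                    ≡⟨ cong (λ t → Σ₁ + t) (cross-shift p q V s m) ⟩
    Σ₁ + cross p q V y                                    ≡⟨ cong (λ t → Σ₁ + t) (cross-as-differences p q V y) ⟩
    Σ₁ + ((V y - V (y - P)) - (V (y - Q) - V (y - Q - P)))
                                                          ≡⟨ cong (λ t → Σ₁ + t) (cong₂ _-_ (V-step y) (V-step (y - Q))) ⟩
    Σ₁ + (window p G y - window p G (y - Q))              ∎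
    where open ≡-Reasoning

  I₁ I₂ : ℤ → Set
  I₁ x = x ∈⟨ m - S - Q - P , m - S - Q ]
  I₂ x = x ∈⟨ m - S - P , m - S ]

  y-q≤y-p : y - Q ℤ.≤ y - P
  y-q≤y-p = ℤP.+-monoʳ-≤ y (ℤP.neg-mono-≤ (ℤ.+≤+ (ℕP.<⇒≤ p<q)))

  I₁∩I₂ : ∀ {x} → I₁ x → ¬ I₂ x
  I₁∩I₂ (_ , x≤y-q) (y-p<x , _) = ℤP.<⇒≱ y-p<x (ℤP.≤-trans x≤y-q y-q≤y-p)

  y-q-p : y - Q - P ≡ y - + (q ℕ.+ p)
  y-q-p = assoc y Q P
    where
    assoc : ∀ y q p → y - q - p ≡ y - (q + p)
    assoc = solve-∀

  I₁⊆union : ∀ {x} → I₁ x → x ∈⟨ y - + (q ℕ.+ p) , y ]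
  I₁⊆union (lower , upper) = subst (ℤ._< _) y-q-p lower , ℤP.≤-trans upper (minus-≤ y q)

  I₂⊆union : ∀ {x} → I₂ x → x ∈⟨ y - + (q ℕ.+ p) , y ]
  I₂⊆union (lower , upper) =
    ℤP.≤-<-trans (subst (ℤ._≤ y - P) (trans (swap-steps y P Q) y-q-p) (minus-≤ (y - P) q)) lower , upper
    where
    swap-steps : ∀ y p q → y - p - q ≡ y - q - p
    swap-steps = solve-∀

  in-union : ∀ {x} → I₁ x ⊎ I₂ x → x ∈⟨ y - + (q ℕ.+ p) , y ]
  in-union (inj₁ x∈I₁) = I₁⊆union x∈I₁
  in-union (inj₂ x∈I₂) = I₂⊆union x∈I₂

  at-most-one : (α β : ℤ) → (I₁ (α * R) ⊎ I₂ (α * R)) → (I₁ (β * R) ⊎ I₂ (β * R)) → α ≡ β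
  at-most-one α β α∈ β∈ = at-most-one-multiple q+p≤r (in-union α∈) (in-union β∈)

  -- the window over I₂ is W(y), the window over I₁ is W(y - q)
  empty-window : ∀ z → (∀ α → ¬ (α * R) ∈⟨ z - P , z ]) → window p G z ≡ + 0
  empty-window z none = window-no-multiple p r G z G-off none

  occupied-window : ∀ z α → (α * R) ∈⟨ z - P , z ] → z ℤ.≤ y → window p G z ≡ χ p q r (α * R)
  occupied-window z α αr∈ z≤y =
    trans (window-one-multiple p r G z α p≤r G-off αr∈) (G-on α (ℤP.≤-trans (proj₂ αr∈) z≤y))

  from-windows : ∀ {u v} → window p G y ≡ u → window p G (y - Q) ≡ v → coeffQ p q r m ≡ Σ₁ + (u - v)
  from-windows W₂≡u W₁≡v = trans decomposition (cong (λ t → Σ₁ + t) (cong₂ _-_ W₂≡u W₁≡v))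

  no-multiple : ((α : ℤ) → ¬ (I₁ (α * R) ⊎ I₂ (α * R))) → coeffQ p q r m ≡ Σ₁
  no-multiple none =
    trans (from-windows (empty-window y (λ α → none α ∘′ inj₂)) (empty-window (y - Q) (λ α → none α ∘′ inj₁)))
          (ℤP.+-identityʳ Σ₁)

  multiple-in-I₁ : (α : ℤ) → I₁ (α * R) → coeffQ p q r m ≡ Σ₁ + (- χ p q r (α * R)) ^ 1
  multiple-in-I₁ α αr∈I₁ =
    trans (from-windows (empty-window y nothing-in-I₂) (occupied-window (y - Q) α αr∈I₁ (minus-≤ y q)))
          (cong (λ t → Σ₁ + t) (negate (χ p q r (α * R))))
    where
    nothing-in-I₂ : ∀ β → ¬ I₂ (β * R)
    nothing-in-I₂ β βr∈I₂ =
      I₁∩I₂ αr∈I₁ (subst (λ γ → I₂ (γ * R)) (at-most-one β α (inj₂ βr∈I₂) (inj₁ αr∈I₁)) βr∈I₂)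
    negate : ∀ c → + 0 - c ≡ (- c) ^ 1
    negate c = trans (ℤP.+-identityˡ (- c)) (sym (ℤP.*-identityʳ (- c)))

  multiple-in-I₂ : (α : ℤ) → I₂ (α * R) → coeffQ p q r m ≡ Σ₁ + (- χ p q r (α * R)) ^ 2
  multiple-in-I₂ α αr∈I₂ =
    trans (from-windows (occupied-window y α αr∈I₂ ℤP.≤-refl) (empty-window (y - Q) nothing-in-I₁))
          (cong (λ t → Σ₁ + t) (idempotent (χ-Ind.zero-or-one (α * R))))
    where
    nothing-in-I₁ : ∀ β → ¬ I₁ (β * R)
    nothing-in-I₁ β βr∈I₁ =
      I₁∩I₂ βr∈I₁ (subst (λ γ → I₂ (γ * R)) (at-most-one α β (inj₂ αr∈I₂) (inj₁ βr∈I₁)) αr∈I₂)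
    -- χ takes only the values 0 and 1, so χ = (-χ)²
    idempotent : ∀ {c} → c ≡ + 0 ⊎ c ≡ + 1 → c - + 0 ≡ (- c) ^ 2
    idempotent (inj₁ refl) = refl
    idempotent (inj₂ refl) = refl

lemma7 : (p q s : ℕ) → 3 ℕ.≤ p → p ℕ.< q → Coprime p q →
  1 ℕ.≤ s → Coprime s (p ℕ.* q) →
  (m : ℤ) → m ℤ.< + (p ℕ.* q ℕ.* (p ℕ.* q ℕ.+ s)) →
  let r = p ℕ.* q ℕ.+ s
      P = + p
      Q = + q
      S = + s
      R = + r
      a = coeffQ p q r m
      Σ₁ = σ p q r s m - σ p q r s (m - P) - σ p q r s (m - Q) + σ p q r s (m - Q - P)
      I₁ : ℤ → Set
      I₁ x = x ∈⟨ m - S - Q - P , m - S - Q ]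
      I₂ : ℤ → Set
      I₂ x = x ∈⟨ m - S - P , m - S ]
  in ((α β : ℤ) → (I₁ (α * R) ⊎ I₂ (α * R)) → (I₁ (β * R) ⊎ I₂ (β * R)) → α ≡ β)
     × (((α : ℤ) → ¬ (I₁ (α * R) ⊎ I₂ (α * R))) → a ≡ Σ₁)
     × ((α : ℤ) → I₁ (α * R) → a ≡ Σ₁ + (- χ p q r (α * R)) ^ 1)
     × ((α : ℤ) → I₂ (α * R) → a ≡ Σ₁ + (- χ p q r (α * R)) ^ 2)
lemma7 p q s 3≤p p<q p⊥q 1≤s s⊥pq m m<pqr = at-most-one , no-multiple , multiple-in-I₁ , multiple-in-I₂
  where open Lemma7 p q s 3≤p p<q p⊥q 1≤s s⊥pq m m<pqr
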